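{- Let $G$ and $H$ be connected graphs with $|V(H)|-1\ge \chi(G)\ge \chi(H)$. Then $\chi(G\,\square\,H)\le \eta(G\,\square\,H)-1$.
   Context: All graphs are finite, simple and undirected. $\chi$ denotes chromatic number. $\eta(G)$ is the maximum $k$ such that $K_k$ is a minor of $G$. The Cartesian product $G\,\square\,H$ has vertex set $V(G)\times V(H)$, with $(v,x)(w,y)$ an edge iff ($vw\in E(G)$ and $x=y$) or ($v=w$ and $xy\in E(H)$). -}

module Defs where

open import Level using (0ℓ)
open import Data.Nat using (ℕ; suc; _*_; _≤_)
open import Data.Fin using (Fin; remQuot)
open import Data.Product using (Σ; ∃; ∃-syntax; _×_; _,_; proj₁; proj₂)
open import Data.Sum using (_⊎_; inj₁; inj₂)
open import Data.Maybe using (Maybe; just)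
open import Data.Empty using (⊥)
open import Relation.Nullary using (¬_)
open import Relation.Binary.PropositionalEquality using (_≡_; _≢_; refl; sym)

record Graph : Set₁ where
  field
    order   : ℕ
    Adj     : Fin order → Fin order → Set
    Adj-sym : ∀ {u v} → Adj u v → Adj v u
    Adj-irr : ∀ {u} → ¬ Adj u u
open Graph public

V : Graph → Set
V G = Fin (order G)

data WalkIn (G : Graph) (P : V G → Set) : V G → V G → Set where
  here : ∀ {u} → P u → WalkIn G P u u
  step : ∀ {u w v} → P u → Adj G u w → WalkIn G P w v → WalkIn G P u v

Connected : Graph → Set
Connected G = (1 ≤ order G) × (∀ u v → WalkIn G (λ _ → Lift⊤) u v)
  where
    open import Data.Unit using () renaming (⊤ to Lift⊤)

Colorable : Graph → ℕ → Set
Colorable G k = Σ (V G → Fin k) λ c → ∀ u v → Adj G u v → c u ≢ c v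

IsChromaticNumber : Graph → ℕ → Set
IsChromaticNumber G k = Colorable G k × (∀ j → Colorable G j → k ≤ j)

-- K_k minor via branch sets: b v = just i means v lies in branch set i.
-- Branch sets are disjoint (b is a function), nonempty, induce connected
-- subgraphs, and any two distinct branch sets are joined by an edge.
HasCliqueMinor : Graph → ℕ → Set
HasCliqueMinor G k =
  Σ (V G → Maybe (Fin k)) λ b →
      (∀ i → ∃[ v ] b v ≡ just i)
    × (∀ i u v → b u ≡ just i → b v ≡ just i → WalkIn G (λ w → b w ≡ just i) u v)
    × (∀ i j → i ≢ j → ∃[ u ] ∃[ v ] (b u ≡ just i × b v ≡ just j × Adj G u v))

IsHadwigerNumber : Graph → ℕ → Set
IsHadwigerNumber G k = HasCliqueMinor G k × (∀ j → HasCliqueMinor G j → j ≤ k)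

-- Cartesian product G □ H, vertex set Fin (|G| * |H|) ≅ V(G) × V(H) via remQuot.
ProdAdj : (G H : Graph) → Fin (order G * order H) → Fin (order G * order H) → Set
ProdAdj G H p q with remQuot {order G} (order H) p | remQuot {order G} (order H) q
... | (v , x) | (w , y) = (Adj G v w × x ≡ y) ⊎ (v ≡ w × Adj H x y)

private
  prod-sym : (G H : Graph) → ∀ {p q} → ProdAdj G H p q → ProdAdj G H q p
  prod-sym G H {p} {q} a with remQuot {order G} (order H) p | remQuot {order G} (order H) q
  prod-sym G H (inj₁ (e , s)) | (v , x) | (w , y) = inj₁ (Adj-sym G e , sym s)
  prod-sym G H (inj₂ (s , e)) | (v , x) | (w , y) = inj₂ (sym s , Adj-sym H e)

  prod-irr : (G H : Graph) → ∀ {p} → ¬ ProdAdj G H p p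
  prod-irr G H {p} a with remQuot {order G} (order H) p
  prod-irr G H (inj₁ (e , _)) | (v , x) = Adj-irr G e
  prod-irr G H (inj₂ (_ , e)) | (v , x) = Adj-irr H e

_□_ : Graph → Graph → Graph
G □ H = record
  { order   = order G * order H
  ; Adj     = ProdAdj G H
  ; Adj-sym = prod-sym G H
  ; Adj-irr = prod-irr G H
  }

module Submission where

-- Write χ(G) = m + 1 (a graph with a vertex needs at least one colour).
--
-- Upper bound χ(G □ H) ≤ m + 1: colour (g , h) by c_G(g) + c_H(h) mod (m + 1).
-- Both summands are residues (χ(H) ≤ m + 1) and translation modulo m + 1 is
-- injective on residues, so adjacent vertices, which agree in one coordinate
-- and get different colours in the other, receive different colours.
--
-- Lower bound η(G □ H) ≥ m + 2: as G is not m-colourable, greedy colouring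
-- shows that some vertex v has m distinct neighbours w₀ … w_{m-1} (a star).
-- Take an edge ι₀ι₁ of H (H is connected with at least m + 2 vertices) and
-- distinct further vertices ι₂ … ι_{m+1}.  The branch sets
--   B₀ = {(v,ι₀)},  B₁ = {(v,ι₁)},  B_{t+2} = {(v,ι_{t+2})} ∪ ({w_t} × V(H))
-- are connected and pairwise adjacent, giving a K_{m+2} minor of G □ H.
--
-- Adjacency is not assumed decidable, so the greedy step only yields the star
-- up to double negation; this suffices because the conclusion is a decidable
-- inequality between natural numbers.

open import Defs
open import Level using (0ℓ)
open import Data.Nat using (ℕ; zero; suc; _+_; _∸_; _≤_; _<_; _%_; z≤n; s≤s; NonZero; _<?_; _≤?_)
open import Data.Nat.Properties using (≤-trans; ≤-refl; <⇒≤; <-irrefl; +-comm; +-assoc; +-identityʳ; m+[n∸m]≡n; m<1+n⇒m<n∨m≡n)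
open import Data.Nat.DivMod using (_mod_; %-distribˡ-+; m%n%n≡m%n; m%n≤n; n%n≡0; m<n⇒m%n≡m)
open import Data.Fin using (Fin; zero; suc; toℕ; fromℕ<; inject≤; punchIn; punchOut; combine; remQuot; _≟_)
open import Data.Fin.Properties using (toℕ-injective; toℕ<n; toℕ-fromℕ<; fromℕ<-injective; inject≤-injective; punchIn-injective; punchInᵢ≢i; punchIn-punchOut; remQuot-combine; combine-remQuot; any?; ¬∀⟶∃¬; sequence)
open import Data.Vec.Functional using (updateAt)
open import Data.Vec.Functional.Properties using (updateAt-updates; updateAt-minimal)
open import Data.Product using (Σ; ∃-syntax; _×_; _,_; proj₁; proj₂; uncurry)
open import Data.Sum using (_⊎_; inj₁; inj₂)
open import Data.Maybe using (Maybe; just; nothing)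
open import Data.Unit using (⊤)
open import Data.Empty using (⊥-elim)
open import Effect.Monad using (RawMonad)
open import Function.Definitions using (Injective)
open import Relation.Nullary using (¬_; Dec; yes; no)
open import Relation.Nullary.Negation using (¬¬-Monad; ¬¬-map)
open import Relation.Nullary.Decidable using (_×-dec_; decidable-stable; ¬¬-excluded-middle)
open import Relation.Binary.PropositionalEquality using (_≡_; _≢_; refl; sym; trans; cong; subst; subst₂; module ≡-Reasoning)

-- Adjacency of a finite graph is decidable up to double negation: excluded
-- middle for each of the finitely many pairs, combined in the ¬¬ monad.
¬¬-decidableAdjacency : (G : Graph) → ¬ ¬ (∀ u v → Dec (Adj G u v))
¬¬-decidableAdjacency G =
  sequence rawApplicative λ u → sequence rawApplicative λ v → ¬¬-excluded-middle
  where open RawMonad (¬¬-Monad {0ℓ}) using (rawApplicative)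

_++ʷ_ : ∀ {G P a b c} → WalkIn G P a b → WalkIn G P b c → WalkIn G P a c
here _       ++ʷ W′ = W′
step p e W   ++ʷ W′ = step p e (W ++ʷ W′)

walkStart : ∀ {G P a b} → WalkIn G P a b → P a
walkStart (here p)     = p
walkStart (step p _ _) = p

reverseOnto : ∀ {G P a b c} → WalkIn G P a b → WalkIn G P a c → WalkIn G P b c
reverseOnto     (here _)     acc = acc
reverseOnto {G} (step _ e W) acc = reverseOnto W (step (walkStart W) (Adj-sym G e) acc)

reverseWalk : ∀ {G P a b} → WalkIn G P a b → WalkIn G P b a
reverseWalk W = reverseOnto W (here (walkStart W))

walk⇒edge : ∀ {G P a b} → WalkIn G P a b → a ≢ b → Σ (V G) λ x → Σ (V G) λ y → Adj G x y
walk⇒edge (here _)           a≢a = ⊥-elim (a≢a refl)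
walk⇒edge (step {u} {w} _ e _) _ = u , w , e

adjacent⇒distinct : ∀ (G : Graph) {x y} → Adj G x y → x ≢ y
adjacent⇒distinct G e refl = Adj-irr G e

-- Coordinates of G □ H: the vertex p corresponds to the pair remQuot p, and
-- by definition adjacency of G □ H is CoordAdj of the coordinate pairs.

module _ (G H : Graph) where

  pair : V G → V H → V (G □ H)
  pair = combine

  coords : V (G □ H) → V G × V H
  coords = remQuot (order H)

  CoordAdj : V G × V H → V G × V H → Set
  CoordAdj (g , h) (g′ , h′) = (Adj G g g′ × h ≡ h′) ⊎ (g ≡ g′ × Adj H h h′)

  pairAdj : ∀ {g h g′ h′} → CoordAdj (g , h) (g′ , h′) → Adj (G □ H) (pair g h) (pair g′ h′)
  pairAdj {g} {h} {g′} {h′} =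
    subst₂ CoordAdj (sym (remQuot-combine g h)) (sym (remQuot-combine g′ h′))

  stepInG : ∀ {g g′ h} → Adj G g g′ → Adj (G □ H) (pair g h) (pair g′ h)
  stepInG e = pairAdj (inj₁ (e , refl))

  stepInH : ∀ {g h h′} → Adj H h h′ → Adj (G □ H) (pair g h) (pair g h′)
  stepInH e = pairAdj (inj₂ (refl , e))

  liftToFibre : ∀ {Q x y} (P : V (G □ H) → Set) (g : V G) → (∀ h → P (pair g h)) →
    WalkIn H Q x y → WalkIn (G □ H) P (pair g x) (pair g y)
  liftToFibre P g inP (here _)     = here (inP _)
  liftToFibre P g inP (step _ e W) = step (inP _) (stepInH e) (liftToFibre P g inP W)

module _ (n : ℕ) .{{_ : NonZero n}} where
  open ≡-Reasoning

  %-absorbʳ : ∀ a b → (a + b % n) % n ≡ (a + b) % n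
  %-absorbʳ a b = begin
    (a + b % n) % n         ≡⟨ %-distribˡ-+ a (b % n) n ⟩
    (a % n + b % n % n) % n ≡⟨ cong (λ z → (a % n + z) % n) (m%n%n≡m%n b n) ⟩
    (a % n + b % n) % n     ≡⟨ sym (%-distribˡ-+ a b n) ⟩
    (a + b) % n             ∎

  %-absorbˡ : ∀ a b → (a % n + b) % n ≡ (a + b) % n
  %-absorbˡ a b = begin
    (a % n + b) % n ≡⟨ cong (_% n) (+-comm (a % n) b) ⟩
    (b + a % n) % n ≡⟨ %-absorbʳ b a ⟩
    (b + a) % n     ≡⟨ cong (_% n) (+-comm b a) ⟩
    (a + b) % n     ∎

  translate-inverse : ∀ a c → a < n → ((a + c) % n + (n ∸ c % n)) % n ≡ a
  translate-inverse a c a<n = begin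
    ((a + c) % n + c⁻) % n ≡⟨ %-absorbˡ (a + c) c⁻ ⟩
    (a + c + c⁻) % n       ≡⟨ cong (_% n) (+-assoc a c c⁻) ⟩
    (a + (c + c⁻)) % n     ≡⟨ sym (%-absorbʳ a (c + c⁻)) ⟩
    (a + (c + c⁻) % n) % n ≡⟨ cong (λ z → (a + z) % n) c+c⁻≡0 ⟩
    (a + 0) % n            ≡⟨ cong (_% n) (+-identityʳ a) ⟩
    a % n                  ≡⟨ m<n⇒m%n≡m a<n ⟩
    a                      ∎
    where
    c⁻ = n ∸ c % n
    c+c⁻≡0 : (c + c⁻) % n ≡ 0
    c+c⁻≡0 = begin
      (c + c⁻) % n     ≡⟨ sym (%-absorbˡ c c⁻) ⟩
      (c % n + c⁻) % n ≡⟨ cong (_% n) (m+[n∸m]≡n (m%n≤n c n)) ⟩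
      n % n            ≡⟨ n%n≡0 n ⟩
      0                ∎

  +-cancelʳ-% : ∀ a b c → a < n → b < n → (a + c) % n ≡ (b + c) % n → a ≡ b
  +-cancelʳ-% a b c a<n b<n eq = begin
    a                                 ≡⟨ sym (translate-inverse a c a<n) ⟩
    ((a + c) % n + (n ∸ c % n)) % n   ≡⟨ cong (λ z → (z + (n ∸ c % n)) % n) eq ⟩
    ((b + c) % n + (n ∸ c % n)) % n   ≡⟨ translate-inverse b c b<n ⟩
    b                                 ∎

  +-cancelˡ-% : ∀ a b c → a < n → b < n → (c + a) % n ≡ (c + b) % n → a ≡ b
  +-cancelˡ-% a b c a<n b<n eq = +-cancelʳ-% a b c a<n b<n (begin
    (a + c) % n ≡⟨ cong (_% n) (+-comm a c) ⟩
    (c + a) % n ≡⟨ eq ⟩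
    (c + b) % n ≡⟨ cong (_% n) (+-comm c b) ⟩
    (b + c) % n ∎)

productColouring : (G H : Graph) {m j : ℕ} →
  Colorable G (suc m) → Colorable H j → j ≤ suc m → Colorable (G □ H) (suc m)
productColouring G H {m} (cG , cG-proper) (cH , cH-proper) j≤k = colour , proper
  where
  k = suc m

  sum : V G × V H → ℕ
  sum (g , h) = toℕ (cG g) + toℕ (cH h)

  colour : V (G □ H) → Fin k
  colour p = sum (coords G H p) mod k

  differentSums : ∀ r s → CoordAdj G H r s → sum r % k ≢ sum s % k
  differentSums (g , h) (g′ , .h) (inj₁ (e , refl)) eq =
    cG-proper g g′ e (toℕ-injective (+-cancelʳ-% k _ _ (toℕ (cH h)) (toℕ<n _) (toℕ<n _) eq))
  differentSums (g , h) (.g , h′) (inj₂ (refl , e)) eq =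
    cH-proper h h′ e (toℕ-injective (+-cancelˡ-% k _ _ (toℕ (cG g))
      (≤-trans (toℕ<n _) j≤k) (≤-trans (toℕ<n _) j≤k) eq))

  proper : ∀ p q → Adj (G □ H) p q → colour p ≢ colour q
  proper p q e same = differentSums (coords G H p) (coords G H q) e (fromℕ<-injective _ _ _ _ same)

Star : Graph → ℕ → Set
Star G m = Σ (V G) λ x → Σ (Fin m → V G) λ w → Injective _≡_ _≡_ w × (∀ t → Adj G x (w t))

-- Greedy colouring: with decidable adjacency and no vertex of degree ≥ m + 1,
-- colouring the vertices in order never needs more than m + 1 colours.
module GreedyColouring (G : Graph) (adj? : ∀ u v → Dec (Adj G u v)) (m : ℕ)
                       (no-star : ¬ Star G (suc m)) where

  Colour : Set
  Colour = Fin (suc m)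

  ProperBelow : ℕ → (V G → Colour) → Set
  ProperBelow t c = ∀ u u′ → toℕ u < t → toℕ u′ < t → Adj G u u′ → c u ≢ c u′

  Blocked : (V G → Colour) → ℕ → V G → Colour → Set
  Blocked c t x j = ∃[ u ] (toℕ u < t × Adj G x u × c u ≡ j)

  blocked? : ∀ c t x j → Dec (Blocked c t x j)
  blocked? c t x j = any? λ u → (toℕ u <? t) ×-dec (adj? x u ×-dec (c u ≟ j))

  -- Choosing one blocking neighbour per colour would give a star K_{1,m+1}.
  notAllBlocked : ∀ c t x → ¬ (∀ j → Blocked c t x j)
  notAllBlocked c t x blocked = no-star (x , neighbour , injective , λ j → proj₁ (proj₂ (proj₂ (blocked j))))
    where
    neighbour : Colour → V G
    neighbour j = proj₁ (blocked j)
    colourOf : ∀ j → c (neighbour j) ≡ j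
    colourOf j = proj₂ (proj₂ (proj₂ (blocked j)))
    injective : Injective _≡_ _≡_ neighbour
    injective {i} {j} eq = trans (sym (colourOf i)) (trans (cong c eq) (colourOf j))

  freeColour : ∀ c t x → Σ Colour λ j → ¬ Blocked c t x j
  freeColour c t x = ¬∀⟶∃¬ _ (Blocked c t x) (blocked? c t x) (notAllBlocked c t x)

  extend : ∀ {t} → t < order G → (c : V G → Colour) → ProperBelow t c →
    Σ (V G → Colour) (ProperBelow (suc t))
  extend {t} t<n c proper = c′ , proper′
    where
    x : V G
    x = fromℕ< t<n
    j : Colour
    j = proj₁ (freeColour c t x)
    c′ : V G → Colour
    c′ = updateAt c x (λ _ → j)

    -- Vertices below t differ from x, so they keep their colour.
    keeps : ∀ u → toℕ u < t → c′ u ≡ c u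
    keeps u u<t = updateAt-minimal u x c u≢x
      where
      u≢x : u ≢ x
      u≢x u≡x = <-irrefl (trans (cong toℕ u≡x) (toℕ-fromℕ< t<n)) u<t

    split : ∀ u → toℕ u < suc t → u ≡ x ⊎ toℕ u < t
    split u u<1+t with m<1+n⇒m<n∨m≡n u<1+t
    ... | inj₁ u<t = inj₂ u<t
    ... | inj₂ u≡t = inj₁ (toℕ-injective (trans u≡t (sym (toℕ-fromℕ< t<n))))

    free : ∀ u → toℕ u < t → Adj G x u → c′ u ≢ c′ x
    free u u<t e same = proj₂ (freeColour c t x)
      (u , u<t , e , trans (sym (keeps u u<t)) (trans same (updateAt-updates x c)))

    proper′ : ProperBelow (suc t) c′
    proper′ u u′ u< u′< e with split u u< | split u′ u′<
    ... | inj₁ refl | inj₁ refl = ⊥-elim (Adj-irr G e)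
    ... | inj₁ refl | inj₂ u′<t = λ same → free u′ u′<t e (sym same)
    ... | inj₂ u<t  | inj₁ refl = free u u<t (Adj-sym G e)
    ... | inj₂ u<t  | inj₂ u′<t = λ same →
      proper u u′ u<t u′<t e (trans (sym (keeps u u<t)) (trans same (keeps u′ u′<t)))

  colourPrefix : ∀ t → t ≤ order G → Σ (V G → Colour) (ProperBelow t)
  colourPrefix zero    _   = (λ _ → zero) , λ _ _ ()
  colourPrefix (suc t) t<n = uncurry (extend t<n) (colourPrefix t (<⇒≤ t<n))

  colouring : Colorable G (suc m)
  colouring with colourPrefix (order G) ≤-refl
  ... | c , proper = c , λ u u′ → proper u u′ (toℕ<n u) (toℕ<n u′)

uncolourable⇒¬¬star : (G : Graph) {m : ℕ} → 1 ≤ order G → ¬ Colorable G m → ¬ ¬ Star G m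
uncolourable⇒¬¬star G {zero}  |G|≥1 _ ¬star = ¬star (fromℕ< |G|≥1 , (λ ()) , (λ { {()} }) , λ ())
uncolourable⇒¬¬star G {suc m} _ ¬colourable ¬star =
  ¬¬-decidableAdjacency G λ adj? → ¬colourable (GreedyColouring.colouring G adj? m ¬star)

nonempty⇒¬0-colourable : (G : Graph) → 1 ≤ order G → ¬ Colorable G 0
nonempty⇒¬0-colourable G |G|≥1 (c , _) with c (fromℕ< |G|≥1)
... | ()

preimage : ∀ {k n} → (Fin k → Fin n) → Fin n → Maybe (Fin k)
preimage f y with any? (λ i → f i ≟ y)
... | yes (i , _) = just i
... | no _        = nothing

preimage-sound : ∀ {k n} (f : Fin k → Fin n) {y i} → preimage f y ≡ just i → f i ≡ y
preimage-sound f {y} found with any? (λ i → f i ≟ y)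
preimage-sound f refl | yes (_ , fi≡y) = fi≡y

preimage-complete : ∀ {k n} (f : Fin k → Fin n) → Injective _≡_ _≡_ f → ∀ i → preimage f (f i) ≡ just i
preimage-complete f f-injective i with any? (λ j → f j ≟ f i)
... | yes (_ , fj≡fi) = cong just (f-injective fj≡fi)
... | no none         = ⊥-elim (none (i , refl))

_◂_ : ∀ {k n} → Fin (suc n) → (Fin k → Fin n) → Fin (suc k) → Fin (suc n)
(x ◂ f) zero    = x
(x ◂ f) (suc i) = punchIn x (f i)

◂-injective : ∀ {k n} (x : Fin (suc n)) {f : Fin k → Fin n} →
  Injective _≡_ _≡_ f → Injective _≡_ _≡_ (x ◂ f)
◂-injective x f-inj {zero}  {zero}  _  = refl
◂-injective x f-inj {zero}  {suc j} eq = ⊥-elim (punchInᵢ≢i x _ (sym eq))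
◂-injective x f-inj {suc i} {zero}  eq = ⊥-elim (punchInᵢ≢i x _ eq)
◂-injective x f-inj {suc i} {suc j} eq = cong suc (f-inj (punchIn-injective x _ _ eq))

injectionThrough : ∀ {m n} {x y : Fin n} → x ≢ y → suc (suc m) ≤ n →
  Σ (Fin (suc (suc m)) → Fin n) λ ι → Injective _≡_ _≡_ ι × ι zero ≡ x × ι (suc zero) ≡ y
injectionThrough {x = x} x≢y (s≤s (s≤s m≤n)) =
  x ◂ (punchOut x≢y ◂ λ t → inject≤ t m≤n) ,
  ◂-injective x (◂-injective (punchOut x≢y) (inject≤-injective m≤n m≤n _ _)) ,
  refl ,
  punchIn-punchOut x≢y

module CliqueMinor (G H : Graph) {m : ℕ}
    (H-connected : ∀ x y → WalkIn H (λ _ → ⊤) x y)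
    (v : V G) (w : Fin m → V G) (w-injective : Injective _≡_ _≡_ w) (v~w : ∀ t → Adj G v (w t))
    (ι : Fin (suc (suc m)) → V H) (ι-injective : Injective _≡_ _≡_ ι)
    (ι₀~ι₁ : Adj H (ι zero) (ι (suc zero))) where

  Branch : Set
  Branch = Fin (suc (suc m))

  data Member : Branch → V G → V H → Set where
    anchor : ∀ i → Member i v (ι i)
    row    : ∀ t h → Member (suc (suc t)) (w t) h

  rowLabel : Maybe (Fin m) → Maybe Branch
  rowLabel (just t) = just (suc (suc t))
  rowLabel nothing  = nothing

  label : V G → V H → Maybe Branch
  label g h with g ≟ v
  ... | yes _ = preimage ι h
  ... | no _  = rowLabel (preimage w g)

  InBranch : Branch → V (G □ H) → Set
  InBranch i p = uncurry label (coords G H p) ≡ just i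

  -- The leaves of the star are not its centre, so rows never meet column v.
  w≢v : ∀ t → w t ≢ v
  w≢v t wt≡v = adjacent⇒distinct G (v~w t) (sym wt≡v)

  member⇒label : ∀ {i g h} → Member i g h → label g h ≡ just i
  member⇒label (anchor i) with v ≟ v
  ... | yes _   = preimage-complete ι ι-injective i
  ... | no v≢v  = ⊥-elim (v≢v refl)
  member⇒label (row t h) with w t ≟ v
  ... | yes wt≡v = ⊥-elim (w≢v t wt≡v)
  ... | no _     = cong rowLabel (preimage-complete w w-injective t)

  label⇒member : ∀ {i g h} → label g h ≡ just i → Member i g h
  label⇒member {i} {g} {h} labelled with g ≟ v
  ... | yes refl = subst (Member i v) (preimage-sound ι labelled) (anchor i)
  ... | no _     = fromRow (preimage w g) refl labelled
    where
    fromRow : ∀ r → preimage w g ≡ r → rowLabel r ≡ just i → Member i g h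
    fromRow (just t) found refl = subst (λ g′ → Member i g′ h) (preimage-sound w found) (row t h)

  inBranch : ∀ {i g h} → Member i g h → InBranch i (pair G H g h)
  inBranch {g = g} {h} member = trans (cong (uncurry label) (remQuot-combine g h)) (member⇒label member)

  -- Every member walks inside its branch to the anchor: along its row of H,
  -- then one step in G to v.
  memberToAnchor : ∀ {i g h} → Member i g h → WalkIn (G □ H) (InBranch i) (pair G H g h) (pair G H v (ι i))
  memberToAnchor (anchor i) = here (inBranch (anchor i))
  memberToAnchor (row t h)  =
    liftToFibre G H (InBranch (suc (suc t))) (w t) (λ h′ → inBranch (row t h′)) (H-connected h (ι (suc (suc t))))
    ++ʷ step (inBranch (row t _)) (stepInG G H (Adj-sym G (v~w t))) (here (inBranch (anchor _)))

  -- Each branch set is connected: any two members meet at the anchor.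
  toAnchor : ∀ i p → InBranch i p → WalkIn (G □ H) (InBranch i) p (pair G H v (ι i))
  toAnchor i p p∈i = subst (λ q → WalkIn (G □ H) (InBranch i) q (pair G H v (ι i)))
    (combine-remQuot {order G} (order H) p)
    (memberToAnchor {i} {proj₁ (coords G H p)} {proj₂ (coords G H p)} (label⇒member p∈i))

  branchConnected : ∀ i p q → InBranch i p → InBranch i q → WalkIn (G □ H) (InBranch i) p q
  branchConnected i p q p∈i q∈i = toAnchor i p p∈i ++ʷ reverseWalk (toAnchor i q q∈i)

  Touch : Branch → Branch → Set
  Touch i j = ∃[ p ] ∃[ q ] (InBranch i p × InBranch j q × Adj (G □ H) p q)

  touch-sym : ∀ {i j} → Touch i j → Touch j i
  touch-sym (p , q , p∈i , q∈j , e) = q , p , q∈j , p∈i , Adj-sym (G □ H) e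

  anchorToRow : ∀ i t → Touch i (suc (suc t))
  anchorToRow i t = _ , _ , inBranch (anchor i) , inBranch (row t (ι i)) , stepInG G H (v~w t)

  anchorEdge : Touch zero (suc zero)
  anchorEdge = _ , _ , inBranch (anchor zero) , inBranch (anchor (suc zero)) , stepInH G H ι₀~ι₁

  touching : ∀ i j → i ≢ j → Touch i j
  touching i                (suc (suc t)) _   = anchorToRow i t
  touching (suc (suc s))    zero          _   = touch-sym (anchorToRow zero s)
  touching (suc (suc s))    (suc zero)    _   = touch-sym (anchorToRow (suc zero) s)
  touching zero             (suc zero)    _   = anchorEdge
  touching (suc zero)       zero          _   = touch-sym anchorEdge
  touching zero             zero          i≢i = ⊥-elim (i≢i refl)
  touching (suc zero)       (suc zero)    i≢i = ⊥-elim (i≢i refl)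

  minor : HasCliqueMinor (G □ H) (suc (suc m))
  minor = (λ p → uncurry label (coords G H p)) ,
          (λ i → _ , inBranch (anchor i)) ,
          branchConnected ,
          touching

twoDistinct : ∀ {n} → 2 ≤ n → Σ (Fin n) λ x → Σ (Fin n) λ y → x ≢ y
twoDistinct (s≤s (s≤s _)) = zero , suc zero , λ ()

connected⇒edge : (H : Graph) → (∀ x y → WalkIn H (λ _ → ⊤) x y) → 2 ≤ order H →
  Σ (V H) λ x → Σ (V H) λ y → Adj H x y
connected⇒edge H H-connected 2≤|H| with twoDistinct 2≤|H|
... | x , y , x≢y = walk⇒edge (H-connected x y) x≢y

starMinor : (G H : Graph) {m : ℕ} → (∀ x y → WalkIn H (λ _ → ⊤) x y) →
  Star G m → suc (suc m) ≤ order H → HasCliqueMinor (G □ H) (suc (suc m))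
starMinor G H H-connected (v , w , w-injective , v~w) 2+m≤|H|
  with connected⇒edge H H-connected (≤-trans (s≤s (s≤s z≤n)) 2+m≤|H|)
... | x , y , x~y with injectionThrough (adjacent⇒distinct H x~y) 2+m≤|H|
... | ι , ι-injective , refl , refl =
  CliqueMinor.minor G H H-connected v w w-injective v~w ι ι-injective x~y

mainTheorem2 : (G H : Graph) → Connected G → Connected H →
    (χG χH : ℕ) → IsChromaticNumber G χG → IsChromaticNumber H χH →
    suc χG ≤ order H → χH ≤ χG →
    (χGH ηGH : ℕ) → IsChromaticNumber (G □ H) χGH → IsHadwigerNumber (G □ H) ηGH →
    suc χGH ≤ ηGH
mainTheorem2 G H (|G|≥1 , _) _ zero _ (colG , _) _ _ _ _ _ _ _ =
  ⊥-elim (nonempty⇒¬0-colourable G |G|≥1 colG)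
mainTheorem2 G H (|G|≥1 , _) (_ , H-connected) (suc m) χH (colG , χG-least) (colH , _)
             χG<|H| χH≤χG χGH ηGH (_ , χGH-least) (_ , ηGH-greatest) =
  decidable-stable (suc χGH ≤? ηGH) (¬¬-map bound star)
  where
  χGH≤χG : χGH ≤ suc m
  χGH≤χG = χGH-least (suc m) (productColouring G H colG colH χH≤χG)

  star : ¬ ¬ Star G m
  star = uncolourable⇒¬¬star G |G|≥1 λ c → <-irrefl refl (χG-least m c)

  bound : Star G m → suc χGH ≤ ηGH
  bound s = ≤-trans (s≤s χGH≤χG) (ηGH-greatest (suc (suc m)) (starMinor G H H-connected s χG<|H|))
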